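{- Let $w\ge 1$, $S\ge 0$, $n\ge 1$ be integers such that $S+\rho i\le w$ for every $1\le i\le n$. Consider the bit-compressed Fenwick layout shifted by one bit to the right, in which, for $1\le i\le n$, the partial sum of node $i$ occupies the bit positions in the half-open interval \[ I_i=\bigl[\, i(S+1)-\nu i-(S+\rho i)+1,\ \ i(S+1)-\nu i+1\,\bigr). \] If $1\le j\le n$ and $j\cdot(S+1)$ is a multiple of $w$, then $I_j$ is contained in a single word-aligned word, namely $I_j\subseteq [\,tw,\,(t+1)w)$ with $t = j(S+1)/w - 1\ge 0$.
   Context: For a positive integer $i$, $\rho i$ is the index (starting from zero) of the lowest bit set to one in the binary representation of $i$, and $\nu i$ is the number of ones in the binary representation of $i$. In a bit-compressed Fenwick tree with leaf bound $B$ and $S=\lceil\lg(B+1)\rceil$, the partial sum of node $i$ is stored in $S+\rho i$ bits, the partial sums of nodes $1,2,\ldots,n$ are laid out consecutively in a bit array (so, since $\sum_{i=1}^{j}(S+\rho i)=j(S+1)-\nu j$, without shift node $i$ occupies bits $[\,i(S+1)-\nu i-(S+\rho i),\ i(S+1)-\nu i)$), and "shifted by one bit to the right" means every bit position is increased by one. Bit positions are numbered from $0$; $w$ is the machine word size, and a word-aligned word is a block of bit positions $[tw,(t+1)w)$ for an integer $t\ge0$. Standing assumption: every partial sum fits in a machine word, i.e. $S+\rho i\le w$ for all $1\le i\le n$. -}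

module Defs where

open import Data.Nat using (ℕ; zero; suc; _+_; _*_; _/_; _%_)

-- Binary digits computed with fuel (fuel ≥ number of bits suffices; we use fuel = i).

ν-aux : ℕ → ℕ → ℕ
ν-aux zero    i = 0
ν-aux (suc f) i = i % 2 + ν-aux f (i / 2)

ν : ℕ → ℕ
ν i = ν-aux i i

ρ-aux : ℕ → ℕ → ℕ
ρ-aux zero    i = 0
ρ-aux (suc f) i with i % 2
... | zero  = suc (ρ-aux f (i / 2))
... | suc _ = 0

-- ρ i : index (from 0) of the lowest set bit of i, for i ≥ 1 (ρ 0 = 0 is a junk value)
ρ : ℕ → ℕ
ρ i = ρ-aux i i

open import Data.Integer using (ℤ; +_; _-_)
  renaming (_+_ to _+ℤ_; _*_ to _*ℤ_)

-- Shifted layout: node i occupies bit positions [ lo S i , hi S i )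
hi : ℕ → ℕ → ℤ
hi S i = (+ (i * (S + 1)) - + ν i) +ℤ + 1

lo : ℕ → ℕ → ℤ
lo S i = ((+ (i * (S + 1)) - + ν i) - + (S + ρ i)) +ℤ + 1

open import Relation.Binary.PropositionalEquality using (_≡_; refl)
private
  t1 : ν 13 ≡ 3
  t1 = refl
  t2 : ρ 12 ≡ 2
  t2 = refl
  t3 : ρ 1 ≡ 0
  t3 = refl
  t4 : ν 1 ≡ 1
  t4 = refl

module Submission where

-- If j(S+1) = (t+1)w, node j ends at bit j(S+1) - ν j + 1 ≤ (t+1)w since ν j ≥ 1, and starts at
-- (t+1)w + 1 - (S + ν j + ρ j).  The binary expansion of j has a one at position ν j + ρ j - 1,
-- so the power of two 2 ^ (ν j + ρ j - 1) is a node ≤ j whose width S + ν j + ρ j - 1 is at most w;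
-- hence node j starts at or after tw.

open import Defs
open import Data.Nat using (ℕ; _+_; _*_; _∸_; _/_; _≤_; _≥_; NonZero)
open import Data.Nat.Divisibility using (_∣_)
open import Data.Integer using (ℤ; +_) renaming (_≤_ to _≤ℤ_; _<_ to _<ℤ_)
open import Data.Product using (_×_)

open import Data.Nat using (zero; suc; _^_; _%_; _<_; z≤n; s≤s; s≤s⁻¹; >-nonZero)
open import Data.Nat.Properties
open import Data.Nat.DivMod using (m≡m%n+[m/n]*n; m%n<n; m/n<m; m*n%n≡0; m*n/n≡m)
open import Data.Nat.Divisibility using (divides)
open import Data.Product using (_,_)
open import Data.Empty using (⊥-elim)
open import Relation.Binary.PropositionalEquality
open import Data.Integer using (_⊖_; _-_; +≤+) renaming (_+_ to _+ℤ_)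
import Data.Integer.Properties as ℤ
open import Data.Integer.Tactic.RingSolver using (solve-∀)

n≤1+m⇒n/2≤m : ∀ {n m} → 1 ≤ n → n ≤ suc m → n / 2 ≤ m
n≤1+m⇒n/2≤m {n} 1≤n n≤1+m =
  s≤s⁻¹ (≤-trans (m/n<m n 2 {{>-nonZero 1≤n}} (s≤s (s≤s z≤n))) n≤1+m)

1≤m*n⇒1≤m : ∀ m {n} → 1 ≤ m * n → 1 ≤ m
1≤m*n⇒1≤m (suc _) _ = s≤s z≤n

n<2^n : ∀ n → n < 2 ^ n
n<2^n zero    = s≤s z≤n
n<2^n (suc n) = begin-strict
  suc n           <⟨ +-monoʳ-< 1 (n<2^n n) ⟩
  1 + 2 ^ n       ≤⟨ +-monoˡ-≤ (2 ^ n) (m^n>0 2 n) ⟩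
  2 ^ n + 2 ^ n   ≡⟨ cong (λ x → 2 ^ n + x) (sym (+-identityʳ (2 ^ n))) ⟩
  2 ^ suc n       ∎
  where open ≤-Reasoning

ν-aux-zero : ∀ f → ν-aux f 0 ≡ 0
ν-aux-zero zero    = refl
ν-aux-zero (suc f) = ν-aux-zero f

ν-aux-positive : ∀ f i → 1 ≤ i → i ≤ f → 1 ≤ ν-aux f i
ν-aux-positive zero    i 1≤i i≤0 = ⊥-elim (<⇒≱ 1≤i i≤0)
ν-aux-positive (suc g) i 1≤i i≤f with i % 2 | m≡m%n+[m/n]*n i 2 | m%n<n i 2
... | zero        | i≡2m | _ =
  ν-aux-positive g (i / 2) (1≤m*n⇒1≤m (i / 2) (≤-trans 1≤i (≤-reflexive i≡2m)))
                           (n≤1+m⇒n/2≤m 1≤i i≤f)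
... | suc zero    | _    | _ = s≤s z≤n
... | suc (suc _) | _    | s≤s (s≤s ())

2^[ν-aux+ρ-aux]≤2* : ∀ f i → 1 ≤ i → i ≤ f → 2 ^ (ν-aux f i + ρ-aux f i) ≤ 2 * i
2^[ν-aux+ρ-aux]≤2* zero    i 1≤i i≤0 = ⊥-elim (<⇒≱ 1≤i i≤0)
2^[ν-aux+ρ-aux]≤2* (suc g) i 1≤i i≤f with i % 2 | m≡m%n+[m/n]*n i 2 | m%n<n i 2
... | zero        | i≡2m | _ = begin
  2 ^ (ν-aux g m + suc (ρ-aux g m))  ≡⟨ cong (2 ^_) (+-suc (ν-aux g m) (ρ-aux g m)) ⟩
  2 * 2 ^ (ν-aux g m + ρ-aux g m)    ≤⟨ *-monoʳ-≤ 2 (2^[ν-aux+ρ-aux]≤2* g m 1≤m (n≤1+m⇒n/2≤m 1≤i i≤f)) ⟩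
  2 * (2 * m)                        ≡⟨ cong (2 *_) (trans (*-comm 2 m) (sym i≡2m)) ⟩
  2 * i                              ∎
  where
  open ≤-Reasoning
  m = i / 2
  1≤m : 1 ≤ m
  1≤m = 1≤m*n⇒1≤m m (≤-trans 1≤i (≤-reflexive i≡2m))
... | suc zero    | i≡1+2m | _ = begin
  2 ^ (suc (ν-aux g m) + 0)  ≡⟨ cong (2 ^_) (+-identityʳ (suc (ν-aux g m))) ⟩
  2 * 2 ^ ν-aux g m          ≤⟨ *-monoʳ-≤ 2 (2^ν-aux≤1+2* m (n≤1+m⇒n/2≤m 1≤i i≤f)) ⟩
  2 * (1 + m * 2)            ≡⟨ cong (2 *_) (sym i≡1+2m) ⟩
  2 * i                      ∎
  where
  open ≤-Reasoning
  m = i / 2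
  2^ν-aux≤1+2* : ∀ k → k ≤ g → 2 ^ ν-aux g k ≤ 1 + k * 2
  2^ν-aux≤1+2* zero    _   = ≤-reflexive (cong (2 ^_) (ν-aux-zero g))
  2^ν-aux≤1+2* (suc k) k≤g = begin
    2 ^ ν-aux g (suc k)                    ≤⟨ ^-monoʳ-≤ 2 (m≤m+n (ν-aux g (suc k)) (ρ-aux g (suc k))) ⟩
    2 ^ (ν-aux g (suc k) + ρ-aux g (suc k)) ≤⟨ 2^[ν-aux+ρ-aux]≤2* g (suc k) (s≤s z≤n) k≤g ⟩
    2 * suc k                              ≡⟨ *-comm 2 (suc k) ⟩
    suc k * 2                              ≤⟨ n≤1+n _ ⟩
    1 + suc k * 2                          ∎
... | suc (suc _) | _ | s≤s (s≤s ())

ρ-aux-even : ∀ f i → i % 2 ≡ 0 → ρ-aux (suc f) i ≡ suc (ρ-aux f (i / 2))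
ρ-aux-even f i i%2≡0 with i % 2 | i%2≡0
... | .zero | refl = refl

ρ-aux-2^ : ∀ k f → k < f → ρ-aux f (2 ^ k) ≡ k
ρ-aux-2^ zero    (suc f) _         = refl
ρ-aux-2^ (suc k) (suc f) (s≤s k<f) = begin
  ρ-aux (suc f) (2 * 2 ^ k)         ≡⟨ ρ-aux-even f (2 * 2 ^ k) (trans (cong (_% 2) 2^k*2) (m*n%n≡0 (2 ^ k) 2)) ⟩
  suc (ρ-aux f (2 * 2 ^ k / 2))     ≡⟨ cong (λ x → suc (ρ-aux f x)) (trans (cong (_/ 2) 2^k*2) (m*n/n≡m (2 ^ k) 2)) ⟩
  suc (ρ-aux f (2 ^ k))             ≡⟨ cong suc (ρ-aux-2^ k f k<f) ⟩
  suc k                             ∎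
  where
  open ≡-Reasoning
  2^k*2 : 2 * 2 ^ k ≡ 2 ^ k * 2
  2^k*2 = *-comm 2 (2 ^ k)

ν-positive : ∀ {i} → 1 ≤ i → 1 ≤ ν i
ν-positive {i} 1≤i = ν-aux-positive i i 1≤i ≤-refl

2^[ν+ρ]≤2* : ∀ {i} → 1 ≤ i → 2 ^ (ν i + ρ i) ≤ 2 * i
2^[ν+ρ]≤2* {i} 1≤i = 2^[ν-aux+ρ-aux]≤2* i i 1≤i ≤-refl

ρ-2^ : ∀ k → ρ (2 ^ k) ≡ k
ρ-2^ k = ρ-aux-2^ k (2 ^ k) (n<2^n k)

S+[ν+ρ]≤1+w : ∀ {w S n j} → (∀ i → 1 ≤ i → i ≤ n → S + ρ i ≤ w) →
              1 ≤ j → j ≤ n → S + (ν j + ρ j) ≤ suc w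
S+[ν+ρ]≤1+w {w} {S} {n} {j} fits 1≤j j≤n with ν j | ν-positive 1≤j | 2^[ν+ρ]≤2* 1≤j
... | suc a | _ | 2^[1+a+ρ]≤2j = begin
  S + suc (a + ρ j)      ≡⟨ +-suc S (a + ρ j) ⟩
  suc (S + (a + ρ j))    ≡⟨ cong (λ k → suc (S + k)) (sym (ρ-2^ (a + ρ j))) ⟩
  suc (S + ρ node)       ≤⟨ s≤s (fits node (m^n>0 2 (a + ρ j)) (≤-trans node≤j j≤n)) ⟩
  suc w                  ∎
  where
  open ≤-Reasoning
  node = 2 ^ (a + ρ j)
  node≤j : node ≤ j
  node≤j = *-cancelˡ-≤ 2 2^[1+a+ρ]≤2j

[m-n]-[o+p]+1≡[1+m]-[o+[n+p]] : ∀ (m n o p : ℤ) →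
  ((m - n) - (o +ℤ p)) +ℤ + 1 ≡ (+ 1 +ℤ m) - (o +ℤ (n +ℤ p))
[m-n]-[o+p]+1≡[1+m]-[o+[n+p]] = solve-∀

[m-n]+1≡[1+m]-n : ∀ (m n : ℤ) → (m - n) +ℤ + 1 ≡ (+ 1 +ℤ m) - n
[m-n]+1≡[1+m]-n = solve-∀

lo≡[1+M]⊖[S+[ν+ρ]] : ∀ S i → lo S i ≡ suc (i * (S + 1)) ⊖ (S + (ν i + ρ i))
lo≡[1+M]⊖[S+[ν+ρ]] S i = begin
  ((+ M - + ν i) - + (S + ρ i)) +ℤ + 1           ≡⟨ cong (λ x → ((+ M - + ν i) - x) +ℤ + 1) (ℤ.pos-+ S (ρ i)) ⟩
  ((+ M - + ν i) - (+ S +ℤ + ρ i)) +ℤ + 1        ≡⟨ [m-n]-[o+p]+1≡[1+m]-[o+[n+p]] (+ M) (+ ν i) (+ S) (+ ρ i) ⟩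
  (+ 1 +ℤ + M) - (+ S +ℤ (+ ν i +ℤ + ρ i))       ≡⟨ cong₂ _-_ (sym (ℤ.pos-+ 1 M)) (sym width) ⟩
  + suc M - + (S + (ν i + ρ i))                  ≡⟨ ℤ.m-n≡m⊖n (suc M) (S + (ν i + ρ i)) ⟩
  suc M ⊖ (S + (ν i + ρ i))                      ∎
  where
  open ≡-Reasoning
  M = i * (S + 1)
  width : + (S + (ν i + ρ i)) ≡ + S +ℤ (+ ν i +ℤ + ρ i)
  width = trans (ℤ.pos-+ S (ν i + ρ i)) (cong (+ S +ℤ_) (ℤ.pos-+ (ν i) (ρ i)))

hi≡[1+M]⊖ν : ∀ S i → hi S i ≡ suc (i * (S + 1)) ⊖ ν i
hi≡[1+M]⊖ν S i = begin
  (+ M - + ν i) +ℤ + 1    ≡⟨ [m-n]+1≡[1+m]-n (+ M) (+ ν i) ⟩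
  (+ 1 +ℤ + M) - + ν i    ≡⟨ cong (_- + ν i) (sym (ℤ.pos-+ 1 M)) ⟩
  + suc M - + ν i         ≡⟨ ℤ.m-n≡m⊖n (suc M) (ν i) ⟩
  suc M ⊖ ν i             ∎
  where
  open ≡-Reasoning
  M = i * (S + 1)

m+n≤o⇒+m≤o⊖n : ∀ m {n o} → m + n ≤ o → + m ≤ℤ o ⊖ n
m+n≤o⇒+m≤o⊖n m m+n≤o =
  subst (+ m ≤ℤ_) (sym (ℤ.⊖-≥ (m+n≤o⇒n≤o m m+n≤o))) (+≤+ (m+n≤o⇒m≤o∸n m m+n≤o))

[1+m]⊖n≤m : ∀ m {n} → 1 ≤ n → suc m ⊖ n ≤ℤ + m
[1+m]⊖n≤m m {suc n} _ = subst (_≤ℤ + m) (sym (ℤ.[1+m]⊖[1+n]≡m⊖n m n)) (ℤ.m⊖n≤m m n)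

lo-lowerBound : ∀ S i z → z + (S + (ν i + ρ i)) ≤ suc (i * (S + 1)) → + z ≤ℤ lo S i
lo-lowerBound S i z bound =
  subst (+ z ≤ℤ_) (sym (lo≡[1+M]⊖[S+[ν+ρ]] S i)) (m+n≤o⇒+m≤o⊖n z bound)

hi-upperBound : ∀ S i → 1 ≤ i → hi S i ≤ℤ + (i * (S + 1))
hi-upperBound S i 1≤i =
  subst (_≤ℤ + (i * (S + 1))) (sym (hi≡[1+M]⊖ν S i)) ([1+m]⊖n≤m (i * (S + 1)) (ν-positive 1≤i))

proposition4 : (w S n j : ℕ) → .{{_ : NonZero w}} → n ≥ 1 →
    (∀ i → 1 ≤ i → i ≤ n → S + ρ i ≤ w) →
    1 ≤ j → j ≤ n → w ∣ j * (S + 1) →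
    (j * (S + 1) / w ≥ 1) ×
    (∀ (p : ℤ) → lo S j ≤ℤ p → p <ℤ hi S j →
       + ((j * (S + 1) / w ∸ 1) * w) ≤ℤ p × p <ℤ + ((j * (S + 1) / w ∸ 1 + 1) * w))
proposition4 w S n j _ fits 1≤j j≤n (divides k M≡kw) with k | M≡kw
... | zero  | M≡0 = ⊥-elim (<⇒≢ (*-mono-≤ 1≤j (m≤n+m 1 S)) (sym M≡0))
... | suc t | M≡[1+t]w with j * (S + 1) / w | trans (cong (_/ w) M≡[1+t]w) (m*n/n≡m (suc t) w)
... | .(suc t) | refl =
  s≤s z≤n , λ p lo≤p p<hi → ℤ.≤-trans wordStart≤lo lo≤p , ℤ.<-≤-trans p<hi hi≤wordEnd
  where
  open ≤-Reasoning
  wordStart≤lo : + (t * w) ≤ℤ lo S j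
  wordStart≤lo = lo-lowerBound S j (t * w) (begin
    t * w + (S + (ν j + ρ j))  ≤⟨ +-monoʳ-≤ (t * w) (S+[ν+ρ]≤1+w fits 1≤j j≤n) ⟩
    t * w + suc w              ≡⟨ +-suc (t * w) w ⟩
    suc (t * w + w)            ≡⟨ cong suc (trans (+-comm (t * w) w) (sym M≡[1+t]w)) ⟩
    suc (j * (S + 1))          ∎)
  hi≤wordEnd : hi S j ≤ℤ + ((t + 1) * w)
  hi≤wordEnd = subst (λ m → hi S j ≤ℤ + m)
                  (trans M≡[1+t]w (cong (_* w) (+-comm 1 t))) (hi-upperBound S j 1≤j)
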